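{- Let $n,k,j$ be integers with $k\ge1$ and $2\le j\le \frac{n-k}{2}$, and let $H_k$ be any graph on $k$ vertices. For $1\le i\le n-k-1$ let $G(i,n-k-i)$ denote the graph on $n$ vertices obtained from disjoint copies of $K_i$, $H_k$ and $K_{n-k-i}$ by joining every vertex of $H_k$ to every vertex of $K_i$ and of $K_{n-k-i}$ (with no edges between $K_i$ and $K_{n-k-i}$). Then $\prod_2(G(j,n-k-j))<\prod_2(G(1,n-k-1))$.
   Context: $\prod_2(G)=\prod_{xy\in E(G)} d(x)d(y)$, where $d(x)$ is the degree of $x$. The same graph $H_k$ is used in both $G(j,n-k-j)$ and $G(1,n-k-1)$. -}

module Defs where

open import Data.Nat using (ℕ; zero; suc; _+_; _*_; _<ᵇ_)
open import Data.Bool using (Bool; true; false; if_then_else_; not; _∧_)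
open import Data.Fin using (Fin; toℕ; splitAt; _≟_)
open import Data.List using (List; []; _∷_; length; filter; map; concatMap; allFin)
open import Data.Nat.ListAction using (product)
open import Data.Sum using (_⊎_; inj₁; inj₂)
open import Data.Product using (_×_; _,_)
open import Relation.Nullary.Decidable using (⌊_⌋)
open import Relation.Binary.PropositionalEquality using (_≡_)

Graph : ℕ → Set
Graph n = Fin n → Fin n → Bool

Symmetric : ∀ {n} → Graph n → Set
Symmetric {n} G = (x y : Fin n) → G x y ≡ G y x

Loopless : ∀ {n} → Graph n → Set
Loopless {n} G = (x : Fin n) → G x x ≡ false

degree : ∀ {n} → Graph n → Fin n → ℕ
degree {n} G x = length (filter (λ y → G x y Data.Bool.≟ true) (allFin n))

-- Edge set: unordered pairs {x,y}, listed once as (x,y) with toℕ x < toℕ y.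
edges : ∀ {n} → Graph n → List (Fin n × Fin n)
edges {n} G =
  concatMap (λ x → map (λ y → (x , y))
    (filter (λ y → ((toℕ x <ᵇ toℕ y) ∧ G x y) Data.Bool.≟ true) (allFin n)))
    (allFin n)

Π₂ : ∀ {n} → Graph n → ℕ
Π₂ G = product (map (λ { (x , y) → degree G x * degree G y }) (edges G))

neq : ∀ {m} → Fin m → Fin m → Bool
neq x y = not ⌊ x ≟ y ⌋

-- G(i, m) built from H on k vertices: vertex set Fin (i + (k + m)),
-- first i vertices = K_i, next k = H_k, last m = K_m.
-- H-side vertex: adjacent to the K_i-block iff it lies in H_k.
toHBlock : ∀ {k m} → Fin k ⊎ Fin m → Bool
toHBlock (inj₁ _) = true
toHBlock (inj₂ _) = false

Gim : (i k m : ℕ) → Graph k → Graph (i + (k + m))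
Gim i k m H u v with splitAt i u | splitAt i v
... | inj₁ a | inj₁ b = neq a b
... | inj₁ _ | inj₂ w = toHBlock (splitAt k w)
... | inj₂ w | inj₁ _ = toHBlock (splitAt k w)
... | inj₂ w | inj₂ w′ with splitAt k w | splitAt k w′
...   | inj₁ h | inj₁ h′ = H h h′
...   | inj₁ _ | inj₂ _  = true
...   | inj₂ _ | inj₁ _  = true
...   | inj₂ b | inj₂ b′ = neq b b′

module Submission where

-- For a simple graph every edge xy contributes the factor
-- d(x) d(y), and every vertex x occurs in exactly d(x) edges, so
--     Π₂(G) = ∏ₓ d(x)^d(x).
-- In G(i,m) (built on H with k = K + 1 vertices, M = i + m) the vertices
-- of K_i have degree i + K, those of K_m degree m + K, and a vertex h of
-- H has degree d_H(h) + M.  Writing s(z) = z^z and A(t) = s(t + K)^t,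
--     Π₂(G(i,m)) = A(i) · A(m) · ∏_h s(d_H(h) + M),
-- where the last factor depends on M only.  The sequence A is strictly
-- log-convex from t = 1 on (this rests on a Bernoulli-type inequality),
-- and for such a sequence A(j) A(M - j) strictly decreases as j moves from
-- 1 towards M/2, which gives the theorem.

open import Defs
open import Algebra.Bundles using (Monoid)
import Algebra.Properties.CommutativeMonoid.Sum as BigOperators
open import Data.Bool using (Bool; true; false; if_then_else_; _∧_; T)
open import Data.Fin using (Fin; toℕ; splitAt; _↑ˡ_; _↑ʳ_; _≟_; punchIn)
  renaming (zero to fzero; suc to fsuc)
open import Data.Fin.Properties using (toℕ-injective; splitAt-↑ˡ; splitAt-↑ʳ; punchInᵢ≢i)
open import Data.List using (List; []; _∷_; _++_; length; filter; map; concatMap; allFin; foldr; tabulate)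
open import Data.List.Properties using (map-tabulate; map-∘; map-++)
open import Data.Nat using (ℕ; zero; suc; _+_; _*_; _∸_; _^_; _≤_; _<_; _<ᵇ_; s≤s; z≤n)
open import Data.Nat.ListAction using (sum; product)
open import Data.Nat.ListAction.Properties using (product-++)
open import Data.Nat.Properties using
  ( *-1-commutativeMonoid; *-1-monoid; *-assoc; *-cancelʳ-<; *-cancelˡ-≤
  ; *-comm; *-identityʳ; *-mono-<; *-mono-≤; *-monoʳ-≤; *-monoˡ-<
  ; *-monoˡ-≤; *-suc; +-0-commutativeMonoid; +-0-monoid; +-comm
  ; +-identityʳ; +-monoˡ-≤; +-suc; +-∸-assoc; <-cmp; <-trans; <ᵇ⇒<; <⇒<ᵇ
  ; <⇒≤; ^-monoʳ-<; ^-monoˡ-≤; ^-zeroˡ; m+[n∸m]≡n; m+n≤o⇒m≤o; m+n≤o⇒m≤o∸n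
  ; m<1+n⇒m<n∨m≡n; m^n>0; m≤m+n; m≤n+m; n<1+n; n≤1+n; suc-injective
  ; ≤-<-trans; ≤-refl; ≤-reflexive; ≤-trans; ≤⇒≯; module ≤-Reasoning
  )
open import Data.Nat.Tactic.RingSolver using (solve-∀)
open import Data.Product using (_×_; _,_)
open import Data.Empty using (⊥-elim)
open import Data.Sum using (inj₁; inj₂)
import Data.Vec.Functional as Vector
open import Function using (_∘_; id)
open import Relation.Binary.Definitions using (tri<; tri≈; tri>)
open import Relation.Binary.PropositionalEquality
open import Relation.Nullary using (yes; no; contradiction)

open BigOperators *-1-commutativeMonoid using ()
  renaming (sum to ∏; sum-cong-≗ to ∏-cong; ∑-distrib-+ to ∏-distrib-*; ∑-comm to ∏-comm)
open BigOperators +-0-commutativeMonoid using ()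
  renaming (sum to ∑; sum-cong-≗ to ∑-cong)

module Blocks {ℓ₁ ℓ₂} (M : Monoid ℓ₁ ℓ₂) where
  open Monoid M using (Carrier; _≈_; _∙_; identityˡ; assoc; ∙-congˡ)
    renaming (sym to ≈-sym; trans to ≈-trans)
  open import Algebra.Properties.Monoid.Sum M using () renaming (sum to ⨁)

  sum-↑ : ∀ a {b} (f : Fin (a + b) → Carrier) →
          ⨁ f ≈ ⨁ (λ (x : Fin a) → f (x ↑ˡ b)) ∙ ⨁ (λ y → f (a ↑ʳ y))
  sum-↑ zero    f = ≈-sym (identityˡ _)
  sum-↑ (suc a) f = ≈-trans (∙-congˡ (sum-↑ a (f ∘ fsuc))) (≈-sym (assoc _ _ _))

  sum-three-blocks : ∀ a b {c} (f : Fin (a + (b + c)) → Carrier) →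
    ⨁ f ≈ ⨁ (λ (x : Fin a) → f (x ↑ˡ (b + c)))
          ∙ (⨁ (λ (y : Fin b) → f (a ↑ʳ (y ↑ˡ c))) ∙ ⨁ (λ z → f (a ↑ʳ (b ↑ʳ z))))
  sum-three-blocks a b {c} f = ≈-trans (sum-↑ a {b + c} f) (∙-congˡ (sum-↑ b {c} (λ w → f (a ↑ʳ w))))

open Blocks *-1-monoid using () renaming (sum-three-blocks to ∏-three-blocks)
open Blocks +-0-monoid using () renaming (sum-three-blocks to ∑-three-blocks)

∏-const : ∀ n c → ∏ {n} (λ _ → c) ≡ c ^ n
∏-const zero    c = refl
∏-const (suc n) c = cong (c *_) (∏-const n c)

∏-positive : ∀ n (f : Fin n → ℕ) → (∀ x → 1 ≤ f x) → 1 ≤ ∏ f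
∏-positive zero    f pos = ≤-refl
∏-positive (suc n) f pos = *-mono-≤ (pos fzero) (∏-positive n (f ∘ fsuc) (pos ∘ fsuc))

when : Bool → ℕ → ℕ
when b c = if b then c else 1

indicator : Bool → ℕ
indicator b = if b then 1 else 0

count : ∀ {n} → (Fin n → Bool) → ℕ
count b = ∑ (indicator ∘ b)

when-* : ∀ b x y → when b (x * y) ≡ when b x * when b y
when-* true  x y = refl
when-* false x y = refl

when-power : ∀ {n} (b : Fin n → Bool) c → ∏ (λ y → when (b y) c) ≡ c ^ count b
when-power {zero}  b c = refl
when-power {suc n} b c with b fzero
... | true  = cong (c *_) (when-power (b ∘ fsuc) c)
... | false = trans (+-identityʳ _) (when-power (b ∘ fsuc) c)

count-cong : ∀ {n} {b c : Fin n → Bool} → (∀ x → b x ≡ c x) → count b ≡ count c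
count-cong b≗c = ∑-cong (cong indicator ∘ b≗c)

count-all : ∀ {n} {b : Fin n → Bool} → (∀ x → b x ≡ true) → count b ≡ n
count-all {zero}          all = refl
count-all {suc n} {b} all rewrite all fzero = cong suc (count-all (all ∘ fsuc))

count-none : ∀ {n} {b : Fin n → Bool} → (∀ x → b x ≡ false) → count b ≡ 0
count-none {zero}          none = refl
count-none {suc n} {b} none rewrite none fzero = count-none (none ∘ fsuc)

foldr-allFin : ∀ {A : Set} (_∙_ : A → A → A) (e : A) {n} (f : Fin n → A) →
               foldr _∙_ e (map f (allFin n)) ≡ Vector.foldr _∙_ e f
foldr-allFin _∙_ e {n} f = trans (cong (foldr _∙_ e) (map-tabulate id f)) (fold-tabulate n f)
  where
  fold-tabulate : ∀ n (g : Fin n → _) → foldr _∙_ e (tabulate g) ≡ Vector.foldr _∙_ e g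
  fold-tabulate zero    g = refl
  fold-tabulate (suc n) g = cong (g fzero ∙_) (fold-tabulate n (g ∘ fsuc))

product-filter : ∀ {A : Set} (b : A → Bool) (f : A → ℕ) (xs : List A) →
  product (map f (filter (λ y → b y Data.Bool.≟ true) xs)) ≡ product (map (λ y → when (b y) (f y)) xs)
product-filter b f []       = refl
product-filter b f (x ∷ xs) with b x
... | true  = cong (f x *_) (product-filter b f xs)
... | false = trans (product-filter b f xs) (sym (+-identityʳ _))

length-filter : ∀ {A : Set} (b : A → Bool) (xs : List A) →
  length (filter (λ y → b y Data.Bool.≟ true) xs) ≡ sum (map (indicator ∘ b) xs)
length-filter b []       = refl
length-filter b (x ∷ xs) with b x
... | true  = cong suc (length-filter b xs)
... | false = length-filter b xs

product-concatMap : ∀ {A B : Set} (w : A → ℕ) (row : B → List A) (xs : List B) →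
  product (map w (concatMap row xs)) ≡ product (map (λ x → product (map w (row x))) xs)
product-concatMap w row []       = refl
product-concatMap w row (x ∷ xs) = begin
  product (map w (row x ++ concatMap row xs))
    ≡⟨ cong product (map-++ w (row x) _) ⟩
  product (map w (row x) ++ map w (concatMap row xs))
    ≡⟨ product-++ (map w (row x)) _ ⟩
  product (map w (row x)) * product (map w (concatMap row xs))
    ≡⟨ cong (product (map w (row x)) *_) (product-concatMap w row xs) ⟩
  product (map w (row x)) * product (map (λ x → product (map w (row x))) xs) ∎
  where open ≡-Reasoning

degree-count : ∀ {n} (G : Graph n) x → degree G x ≡ count (G x)
degree-count {n} G x = trans (length-filter (G x) (allFin n)) (foldr-allFin _+_ 0 (indicator ∘ G x))

-- The vertex formula  Π₂(G) = ∏ₓ d(x)^d(x)  for simple graphs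

listed : ∀ {n} → Graph n → Fin n → Fin n → Bool
listed G x y = (toℕ x <ᵇ toℕ y) ∧ G x y

Π₂-over-pairs : ∀ {n} (G : Graph n) →
  Π₂ G ≡ ∏ (λ x → ∏ (λ y → when (listed G x y) (degree G x * degree G y)))
Π₂-over-pairs {n} G = begin
  Π₂ G ≡⟨ product-concatMap w row (allFin n) ⟩
  product (map (λ x → product (map w (row x))) (allFin n)) ≡⟨ foldr-allFin _*_ 1 (λ x → product (map w (row x))) ⟩
  ∏ (λ x → product (map w (row x))) ≡⟨ ∏-cong row-product ⟩
  ∏ (λ x → ∏ (λ y → when (listed G x y) (d x * d y))) ∎
  where
  open ≡-Reasoning
  d = degree G
  w : Fin n × Fin n → ℕ
  w (x , y) = d x * d y
  row : Fin n → List (Fin n × Fin n)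
  row x = map (x ,_) (filter (λ y → listed G x y Data.Bool.≟ true) (allFin n))
  row-product : ∀ x → product (map w (row x)) ≡ ∏ (λ y → when (listed G x y) (d x * d y))
  row-product x = begin
    product (map w (row x))
      ≡⟨ cong product (sym (map-∘ {g = w} {f = x ,_} (filter (λ y → listed G x y Data.Bool.≟ true) (allFin n)))) ⟩
    product (map (λ y → d x * d y) (filter (λ y → listed G x y Data.Bool.≟ true) (allFin n)))
      ≡⟨ product-filter (listed G x) (λ y → d x * d y) (allFin n) ⟩
    product (map (λ y → when (listed G x y) (d x * d y)) (allFin n))
      ≡⟨ foldr-allFin _*_ 1 (λ y → when (listed G x y) (d x * d y)) ⟩
    ∏ (λ y → when (listed G x y) (d x * d y)) ∎

<ᵇ-true : ∀ {m n} → m < n → (m <ᵇ n) ≡ true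
<ᵇ-true {m} {n} m<n with m <ᵇ n in eq
... | true  = refl
... | false = ⊥-elim (subst T eq (<⇒<ᵇ m<n))

<ᵇ-false : ∀ {m n} → n ≤ m → (m <ᵇ n) ≡ false
<ᵇ-false {m} {n} n≤m with m <ᵇ n in eq
... | false = refl
... | true  = contradiction (<ᵇ⇒< m n (subst T (sym eq) _)) (≤⇒≯ n≤m)

listed-pair : ∀ {n} (G : Graph n) → Symmetric G → Loopless G → ∀ x y c →
  when (listed G x y) c * when (listed G y x) c ≡ when (G x y) c
listed-pair G symG loopG x y c with <-cmp (toℕ x) (toℕ y)
... | tri< x<y _ _ rewrite <ᵇ-true x<y | <ᵇ-false (<⇒≤ x<y) = *-identityʳ _
... | tri> _ _ y<x rewrite <ᵇ-false (<⇒≤ y<x) | <ᵇ-true y<x | symG y x = +-identityʳ _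
... | tri≈ _ x≡y _ with toℕ-injective x≡y
...   | refl rewrite <ᵇ-false (≤-refl {toℕ x}) | loopG x = refl

-- Splitting each edge factor d(x) d(y) into d(x) and d(y), regrouping the
-- d(y) factors by their vertex y, and merging the two ordered pairs of an
-- edge shows that every vertex x contributes d(x) once per neighbour.
Π₂-vertex-formula : ∀ {n} (G : Graph n) → Symmetric G → Loopless G →
  Π₂ G ≡ ∏ (λ x → degree G x ^ degree G x)
Π₂-vertex-formula {n} G symG loopG = begin
  Π₂ G
    ≡⟨ Π₂-over-pairs G ⟩
  ∏ (λ x → ∏ (λ y → when (e x y) (d x * d y)))
    ≡⟨ ∏-cong split-edge ⟩
  ∏ (λ x → first x * ∏ (λ y → when (e x y) (d y)))
    ≡⟨ ∏-distrib-* first (λ x → ∏ (λ y → when (e x y) (d y))) ⟩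
  ∏ first * ∏ (λ x → ∏ (λ y → when (e x y) (d y)))
    ≡⟨ cong (∏ first *_) (∏-comm (λ x y → when (e x y) (d y))) ⟩
  ∏ first * ∏ second
    ≡⟨ sym (∏-distrib-* first second) ⟩
  ∏ (λ x → first x * second x)
    ≡⟨ ∏-cong merge-pairs ⟩
  ∏ (λ x → d x ^ d x) ∎
  where
  open ≡-Reasoning
  d = degree G
  e = listed G
  first second : Fin n → ℕ
  first  x = ∏ (λ y → when (e x y) (d x))
  second x = ∏ (λ y → when (e y x) (d x))
  split-edge : ∀ x → ∏ (λ y → when (e x y) (d x * d y)) ≡ first x * ∏ (λ y → when (e x y) (d y))
  split-edge x = trans (∏-cong (λ y → when-* (e x y) (d x) (d y)))
                       (∏-distrib-* (λ y → when (e x y) (d x)) (λ y → when (e x y) (d y)))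
  merge-pairs : ∀ x → first x * second x ≡ d x ^ d x
  merge-pairs x = begin
    first x * second x
      ≡⟨ sym (∏-distrib-* (λ y → when (e x y) (d x)) (λ y → when (e y x) (d x))) ⟩
    ∏ (λ y → when (e x y) (d x) * when (e y x) (d x))
      ≡⟨ ∏-cong (λ y → listed-pair G symG loopG x y (d x)) ⟩
    ∏ (λ y → when (G x y) (d x))
      ≡⟨ when-power (G x) (d x) ⟩
    d x ^ count (G x)
      ≡⟨ cong (d x ^_) (sym (degree-count G x)) ⟩
    d x ^ d x ∎

neq-diag : ∀ {n} (a : Fin n) → neq a a ≡ false
neq-diag a with a ≟ a
... | yes _  = refl
... | no a≢a = contradiction refl a≢a

neq-distinct : ∀ {n} {a b : Fin n} → a ≢ b → neq a b ≡ true
neq-distinct {a = a} {b} a≢b with a ≟ b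
... | yes a≡b = contradiction a≡b a≢b
... | no _    = refl

neq-sym : ∀ {n} (a b : Fin n) → neq a b ≡ neq b a
neq-sym a b with a ≟ b
... | yes refl = sym (neq-diag a)
... | no a≢b   = sym (neq-distinct (a≢b ∘ sym))

-- Each vertex of K_n has n - 1 neighbours: removing a from the count
-- leaves only indices distinct from a.
count-others : ∀ {n} (a : Fin n) → suc (count (neq a)) ≡ n
count-others {suc n} a = cong suc (begin
  count (neq a)
    ≡⟨ BigOperators.sum-remove +-0-commutativeMonoid {i = a} (indicator ∘ neq a) ⟩
  indicator (neq a a) + ∑ (λ j → indicator (neq a (punchIn a j)))
    ≡⟨ cong₂ _+_ (cong indicator (neq-diag a))
                 (count-all (λ j → neq-distinct (punchInᵢ≢i a j ∘ sym))) ⟩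
  n ∎)
  where open ≡-Reasoning

-- The graphs G(i,m): simplicity, blocks and degrees

module JoinGraph (i k m : ℕ) (H : Graph k) where

  G : Graph (i + (k + m))
  G = Gim i k m H

  Gim-symmetric : Symmetric H → Symmetric G
  Gim-symmetric symH u v with splitAt i u | splitAt i v
  ... | inj₁ a | inj₁ b = neq-sym a b
  ... | inj₁ _ | inj₂ _ = refl
  ... | inj₂ _ | inj₁ _ = refl
  ... | inj₂ w | inj₂ w′ with splitAt k w | splitAt k w′
  ...   | inj₁ h | inj₁ h′ = symH h h′
  ...   | inj₁ _ | inj₂ _  = refl
  ...   | inj₂ _ | inj₁ _  = refl
  ...   | inj₂ c | inj₂ c′ = neq-sym c c′

  Gim-loopless : Loopless H → Loopless G
  Gim-loopless loopH u with splitAt i u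
  ... | inj₁ a = neq-diag a
  ... | inj₂ w with splitAt k w
  ...   | inj₁ h = loopH h
  ...   | inj₂ c = neq-diag c

  left : Fin i → Fin (i + (k + m))
  left a = a ↑ˡ (k + m)

  hub : Fin k → Fin (i + (k + m))
  hub h = i ↑ʳ (h ↑ˡ m)

  right : Fin m → Fin (i + (k + m))
  right c = i ↑ʳ (k ↑ʳ c)

  left-left : ∀ a b → G (left a) (left b) ≡ neq a b
  left-left a b rewrite splitAt-↑ˡ i a (k + m) | splitAt-↑ˡ i b (k + m) = refl

  left-hub : ∀ a h → G (left a) (hub h) ≡ true
  left-hub a h rewrite splitAt-↑ˡ i a (k + m) | splitAt-↑ʳ i (k + m) (h ↑ˡ m) | splitAt-↑ˡ k h m = refl

  left-right : ∀ a c → G (left a) (right c) ≡ false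
  left-right a c rewrite splitAt-↑ˡ i a (k + m) | splitAt-↑ʳ i (k + m) (k ↑ʳ c) | splitAt-↑ʳ k m c = refl

  hub-left : ∀ h b → G (hub h) (left b) ≡ true
  hub-left h b rewrite splitAt-↑ˡ i b (k + m) | splitAt-↑ʳ i (k + m) (h ↑ˡ m) | splitAt-↑ˡ k h m = refl

  hub-hub : ∀ h h′ → G (hub h) (hub h′) ≡ H h h′
  hub-hub h h′ rewrite splitAt-↑ʳ i (k + m) (h ↑ˡ m) | splitAt-↑ʳ i (k + m) (h′ ↑ˡ m)
                     | splitAt-↑ˡ k h m | splitAt-↑ˡ k h′ m = refl

  hub-right : ∀ h c → G (hub h) (right c) ≡ true
  hub-right h c rewrite splitAt-↑ʳ i (k + m) (h ↑ˡ m) | splitAt-↑ʳ i (k + m) (k ↑ʳ c)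
                      | splitAt-↑ˡ k h m | splitAt-↑ʳ k m c = refl

  right-left : ∀ c b → G (right c) (left b) ≡ false
  right-left c b rewrite splitAt-↑ˡ i b (k + m) | splitAt-↑ʳ i (k + m) (k ↑ʳ c) | splitAt-↑ʳ k m c = refl

  right-hub : ∀ c h → G (right c) (hub h) ≡ true
  right-hub c h rewrite splitAt-↑ʳ i (k + m) (h ↑ˡ m) | splitAt-↑ʳ i (k + m) (k ↑ʳ c)
                      | splitAt-↑ˡ k h m | splitAt-↑ʳ k m c = refl

  right-right : ∀ c c′ → G (right c) (right c′) ≡ neq c c′
  right-right c c′ rewrite splitAt-↑ʳ i (k + m) (k ↑ʳ c) | splitAt-↑ʳ i (k + m) (k ↑ʳ c′)
                         | splitAt-↑ʳ k m c | splitAt-↑ʳ k m c′ = refl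

  degree-by-blocks : ∀ u → degree G u ≡
    count (λ a → G u (left a)) + (count (λ h → G u (hub h)) + count (λ c → G u (right c)))
  degree-by-blocks u = trans (degree-count G u) (∑-three-blocks i k (indicator ∘ G u))

  degree-left : ∀ a → suc (degree G (left a)) ≡ i + k
  degree-left a = begin
    suc (degree G (left a))
      ≡⟨ cong suc (degree-by-blocks (left a)) ⟩
    suc (count (λ b → G (left a) (left b)) + (count (λ h → G (left a) (hub h)) + count (λ c → G (left a) (right c))))
      ≡⟨ cong suc (cong₂ _+_ (count-cong (left-left a))
                              (cong₂ _+_ (count-all (left-hub a)) (count-none (left-right a)))) ⟩
    suc (count (neq a) + (k + 0))
      ≡⟨ cong₂ _+_ (count-others a) (+-identityʳ k) ⟩
    i + k ∎
    where open ≡-Reasoning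

  degree-hub : ∀ h → degree G (hub h) ≡ i + (degree H h + m)
  degree-hub h = begin
    degree G (hub h)
      ≡⟨ degree-by-blocks (hub h) ⟩
    count (λ b → G (hub h) (left b)) + (count (λ h′ → G (hub h) (hub h′)) + count (λ c → G (hub h) (right c)))
      ≡⟨ cong₂ _+_ (count-all (hub-left h))
                   (cong₂ _+_ (trans (count-cong (hub-hub h)) (sym (degree-count H h)))
                              (count-all (hub-right h))) ⟩
    i + (degree H h + m) ∎
    where open ≡-Reasoning

  degree-right : ∀ c → suc (degree G (right c)) ≡ m + k
  degree-right c = begin
    suc (degree G (right c))
      ≡⟨ cong suc (degree-by-blocks (right c)) ⟩
    suc (count (λ b → G (right c) (left b)) + (count (λ h → G (right c) (hub h)) + count (λ c′ → G (right c) (right c′))))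
      ≡⟨ cong suc (cong₂ _+_ (count-none (right-left c))
                              (cong₂ _+_ (count-all (right-hub c)) (count-cong (right-right c)))) ⟩
    suc (k + count (neq c))
      ≡⟨ sym (+-suc k _) ⟩
    k + suc (count (neq c))
      ≡⟨ cong (k +_) (count-others c) ⟩
    k + m
      ≡⟨ +-comm k m ⟩
    m + k ∎
    where open ≡-Reasoning

selfPower : ℕ → ℕ
selfPower z = z ^ z

-- Contribution of a clique block of t vertices, each of degree t + K.
cliqueFactor : ℕ → ℕ → ℕ
cliqueFactor K t = selfPower (t + K) ^ t

-- Contribution of the vertices of H when the two cliques have M vertices.
hubFactor : ∀ {k} → Graph k → ℕ → ℕ
hubFactor H M = ∏ (λ h → selfPower (degree H h + M))

Π₂-Gim : ∀ i K m (H : Graph (suc K)) → Symmetric H → Loopless H →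
  Π₂ (Gim i (suc K) m H) ≡ cliqueFactor K i * cliqueFactor K m * hubFactor H (i + m)
Π₂-Gim i K m H symH loopH = begin
  Π₂ G
    ≡⟨ Π₂-vertex-formula G (Gim-symmetric symH) (Gim-loopless loopH) ⟩
  ∏ (λ u → selfPower (degree G u))
    ≡⟨ ∏-three-blocks i (suc K) (selfPower ∘ degree G) ⟩
  ∏ (λ a → selfPower (degree G (left a)))
    * (∏ (λ h → selfPower (degree G (hub h))) * ∏ (λ c → selfPower (degree G (right c))))
    ≡⟨ cong₂ _*_ (clique-block i (selfPower ∘ degree G ∘ left) (λ a → cong selfPower (clique-degree i (degree-left a))))
         (cong₂ _*_ (∏-cong (λ h → cong selfPower (hub-degree h)))
                    (clique-block m (selfPower ∘ degree G ∘ right) (λ c → cong selfPower (clique-degree m (degree-right c))))) ⟩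
  cliqueFactor K i * (hubFactor H (i + m) * cliqueFactor K m)
    ≡⟨ rearrange (cliqueFactor K i) (hubFactor H (i + m)) (cliqueFactor K m) ⟩
  cliqueFactor K i * cliqueFactor K m * hubFactor H (i + m) ∎
  where
  open ≡-Reasoning
  open JoinGraph i (suc K) m H
  clique-degree : ∀ t {d} → suc d ≡ t + suc K → d ≡ t + K
  clique-degree t e = suc-injective (trans e (+-suc t K))
  clique-block : ∀ t (f : Fin t → ℕ) → (∀ x → f x ≡ selfPower (t + K)) → ∏ f ≡ cliqueFactor K t
  clique-block t f eq = trans (∏-cong eq) (∏-const t _)
  hub-degree : ∀ h → degree G (hub h) ≡ degree H h + (i + m)
  hub-degree h = trans (degree-hub h) (+-comm-middle i (degree H h) m)
    where
    +-comm-middle : ∀ a b c → a + (b + c) ≡ b + (a + c)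
    +-comm-middle = solve-∀
  rearrange : ∀ a b c → a * (b * c) ≡ a * c * b
  rearrange = solve-∀

-- Numerical part: the clique factors are strictly log-convex

power-of-product : ∀ n a b → (a * b) ^ n ≡ a ^ n * b ^ n
power-of-product zero    a b = refl
power-of-product (suc n) a b = begin
  a * b * (a * b) ^ n     ≡⟨ cong (a * b *_) (power-of-product n a b) ⟩
  a * b * (a ^ n * b ^ n) ≡⟨ interchange a b (a ^ n) (b ^ n) ⟩
  a * a ^ n * (b * b ^ n) ∎
  where
  open ≡-Reasoning
  interchange : ∀ a b c d → a * b * (c * d) ≡ a * c * (b * d)
  interchange = solve-∀

bernoulli : ∀ x N d → x + d ≡ N → suc N ^ x * d ≤ N ^ suc x
bernoulli zero N d refl = ≤-reflexive (trans (+-identityʳ d) (sym (*-identityʳ d)))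
bernoulli (suc x) N d x+d≡N = begin
  suc N * q * d ≡⟨ swap₁ (suc N) q d ⟩
  q * (suc N * d) ≤⟨ *-monoʳ-≤ q one-step ⟩
  q * (N * suc d) ≡⟨ swap₂ q N (suc d) ⟩
  N * (q * suc d) ≤⟨ *-monoʳ-≤ N (bernoulli x N (suc d) (trans (+-suc x d) x+d≡N)) ⟩
  N * N ^ suc x ∎
  where
  open ≤-Reasoning
  q = suc N ^ x
  swap₁ : ∀ a b c → a * b * c ≡ b * (a * c)
  swap₁ = solve-∀
  swap₂ : ∀ a b c → a * (b * c) ≡ b * (a * c)
  swap₂ = solve-∀
  -- (N + 1) d ≤ N (d + 1) since d ≤ N.
  one-step : suc N * d ≤ N * suc d
  one-step = subst (suc N * d ≤_) (sym (*-suc N d))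
    (+-monoˡ-≤ (N * d) (subst (d ≤_) x+d≡N (m≤n+m d (suc x))))

-- z ↦ z^z is log-convex from 1 on:  s(x+1)² ≤ s(x) · s(x+2).
-- With q = x + 1, t = x + 2 and N = x t = q² - 1 this reads
-- (N+1)^q ≤ N^x t², which follows from Bernoulli with d = x q.
selfPower-logConvex : ∀ x → 1 ≤ x → selfPower (suc x) * selfPower (suc x) ≤ selfPower x * selfPower (suc (suc x))
selfPower-logConvex x@(suc _) _ = begin
  q ^ q * q ^ q ≡⟨ sym (power-of-product q q q) ⟩
  (q * q) ^ q ≡⟨ *-comm (q * q) ((q * q) ^ x) ⟩
  (q * q) ^ x * (q * q) ≡⟨ cong (λ z → z ^ x * (q * q)) (square-q x) ⟩
  suc N ^ x * (q * q) ≡⟨ sym (*-assoc (suc N ^ x) q q) ⟩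
  suc N ^ x * q * q ≤⟨ *-monoˡ-≤ q key ⟩
  N ^ x * t * q ≤⟨ *-monoʳ-≤ (N ^ x * t) (n≤1+n q) ⟩
  N ^ x * t * t ≡⟨ *-assoc (N ^ x) t t ⟩
  N ^ x * (t * t) ≡⟨ cong (_* (t * t)) (power-of-product x x t) ⟩
  x ^ x * t ^ x * (t * t) ≡⟨ regroup (x ^ x) (t ^ x) t ⟩
  x ^ x * (t * (t * t ^ x)) ∎
  where
  open ≤-Reasoning
  q = suc x
  t = suc q
  N = x * t
  square-q : ∀ x → (1 + x) * (1 + x) ≡ 1 + x * (2 + x)
  square-q = solve-∀
  regroup : ∀ a b c → a * b * (c * c) ≡ a * (c * (c * b))
  regroup = solve-∀
  -- (N+1)^x q ≤ N^x t, Bernoulli's inequality divided by x.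
  key : suc N ^ x * q ≤ N ^ x * t
  key = *-cancelˡ-≤ x (begin
    x * (suc N ^ x * q) ≡⟨ swap x (suc N ^ x) q ⟩
    suc N ^ x * (x * q) ≤⟨ bernoulli x N (x * q) (N-split x) ⟩
    x * t * N ^ x ≡⟨ regroup′ x t (N ^ x) ⟩
    x * (N ^ x * t) ∎)
    where
    swap : ∀ a b c → a * (b * c) ≡ b * (a * c)
    swap = solve-∀
    N-split : ∀ x → x + x * (1 + x) ≡ x * (2 + x)
    N-split = solve-∀
    regroup′ : ∀ a b c → a * b * c ≡ a * (c * b)
    regroup′ = solve-∀

selfPower-positive : ∀ z → 1 ≤ selfPower z
selfPower-positive zero    = ≤-refl
selfPower-positive (suc z) = m^n>0 (suc z) (suc z)

-- z ↦ z^z is strictly increasing from 1 on (s(0) = s(1) = 1).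
selfPower-< : ∀ x → selfPower (suc x) < selfPower (suc (suc x))
selfPower-< x = ≤-<-trans (^-monoˡ-≤ (suc x) (n≤1+n (suc x)))
                          (^-monoʳ-< (suc (suc x)) (s≤s (s≤s z≤n)) (n<1+n (suc x)))

*-mono-<-≤ : ∀ {a b c d} → a < b → c ≤ d → 1 ≤ d → a * c < b * d
*-mono-<-≤ {a} {b} {c} {d@(suc _)} a<b c≤d _ = ≤-<-trans (*-monoʳ-≤ a c≤d) (*-monoˡ-< d a<b)

cliqueFactor-logConvex : ∀ K t → 1 ≤ t →
  cliqueFactor K (suc t) * cliqueFactor K (suc t) < cliqueFactor K t * cliqueFactor K (suc (suc t))
cliqueFactor-logConvex K t 1≤t = begin-strict
  a ^ suc t * a ^ suc t ≡⟨ sym (power-of-product (suc t) a a) ⟩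
  (a * a) * (a * a) ^ t     <⟨ *-mono-<-≤ (*-mono-< (selfPower-< x) (selfPower-< x))
                                 (^-monoˡ-≤ t (selfPower-logConvex x (≤-trans 1≤t (m≤m+n t K))))
                                 (power-positive (*-mono-≤ (selfPower-positive x) (selfPower-positive (suc (suc x))))) ⟩
  (c * c) * (b * c) ^ t     ≡⟨ cong ((c * c) *_) (power-of-product t b c) ⟩
  (c * c) * (b ^ t * c ^ t) ≡⟨ regroup b c (b ^ t) (c ^ t) ⟩
  b ^ t * (c * (c * c ^ t)) ∎
  where
  open ≤-Reasoning
  x = t + K
  a = selfPower (suc x)
  b = selfPower x
  c = selfPower (suc (suc x))
  power-positive : 1 ≤ b * c → 1 ≤ (b * c) ^ t
  power-positive p = subst (_≤ (b * c) ^ t) (^-zeroˡ t) (^-monoˡ-≤ t p)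
  regroup : ∀ b c u v → (c * c) * (u * v) ≡ u * (c * (c * v))
  regroup = solve-∀

-- Strictly log-convex sequences

module LogConvexSequence (f : ℕ → ℕ)
  (logConvex : ∀ t → 1 ≤ t → f (suc t) * f (suc t) < f t * f (suc (suc t))) where

  exchange : ∀ s u → 1 ≤ s → s < u → f (suc s) * f u < f s * f (suc u)
  exchange s (suc u) 1≤s s<u+1 with m<1+n⇒m<n∨m≡n s<u+1
  ... | inj₂ refl = logConvex s 1≤s
  ... | inj₁ s<u  = *-cancelʳ-< (f u * f (suc u)) _ _
    (subst₂ _<_ (regroupˡ (f (suc s)) (f u) (f (suc u)))
                (regroupʳ (f s) (f (suc u)) (f u) (f (suc (suc u))))
                (*-mono-< (exchange s u 1≤s s<u) (logConvex u (≤-trans 1≤s (<⇒≤ s<u)))))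
    where
    regroupˡ : ∀ a b c → a * b * (c * c) ≡ a * c * (b * c)
    regroupˡ = solve-∀
    regroupʳ : ∀ a c b d → a * c * (b * d) ≡ a * d * (b * c)
    regroupʳ = solve-∀

  balanced-step : ∀ M i → 1 ≤ i → 2 * suc i ≤ M →
    f (suc i) * f (M ∸ suc i) < f i * f (M ∸ i)
  balanced-step M i 1≤i 2[i+1]≤M =
    subst (λ z → f (suc i) * f (M ∸ suc i) < f i * f z)
          (sym (+-∸-assoc 1 i+1≤M)) (exchange i (M ∸ suc i) 1≤i i<rest)
    where
    twice : suc i + suc i ≤ M
    twice = subst (_≤ M) (cong (suc i +_) (+-identityʳ (suc i))) 2[i+1]≤M
    i+1≤M : suc i ≤ M
    i+1≤M = m+n≤o⇒m≤o (suc i) twice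
    i<rest : i < M ∸ suc i
    i<rest = m+n≤o⇒m≤o∸n (suc i) twice

  edge-maximal : ∀ M j → 2 ≤ j → 2 * j ≤ M → f j * f (M ∸ j) < f 1 * f (M ∸ 1)
  edge-maximal M (suc (suc zero))    (s≤s (s≤s z≤n)) 2j≤M = balanced-step M 1 ≤-refl 2j≤M
  edge-maximal M (suc (suc (suc p))) (s≤s (s≤s z≤n)) 2j≤M =
    <-trans (balanced-step M (suc (suc p)) (s≤s z≤n) 2j≤M)
            (edge-maximal M (suc (suc p)) (s≤s (s≤s z≤n))
                          (≤-trans (*-monoʳ-≤ 2 (n≤1+n (suc (suc p)))) 2j≤M))

lemma3p5 : (n k j : ℕ) (H : Graph k) → Symmetric H → Loopless H →
    1 ≤ k → 2 ≤ j → 2 * j ≤ n ∸ k →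
    Π₂ (Gim j k (n ∸ k ∸ j) H) < Π₂ (Gim 1 k (n ∸ k ∸ 1) H)
lemma3p5 n (suc K) j H symH loopH _ 2≤j 2j≤M = begin-strict
  Π₂ (Gim j k (M ∸ j) H)     ≡⟨ Π₂-Gim j K (M ∸ j) H symH loopH ⟩
  B j * hubFactor H (j + (M ∸ j)) ≡⟨ cong (λ s → B j * hubFactor H s) (m+[n∸m]≡n j≤M) ⟩
  B j * hubFactor H M        <⟨ *-mono-<-≤ (edge-maximal M j 2≤j 2j≤M) ≤-refl hub-positive ⟩
  B 1 * hubFactor H M        ≡⟨ cong (λ s → B 1 * hubFactor H s) (sym (m+[n∸m]≡n 1≤M)) ⟩
  B 1 * hubFactor H (1 + (M ∸ 1)) ≡⟨ sym (Π₂-Gim 1 K (M ∸ 1) H symH loopH) ⟩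
  Π₂ (Gim 1 k (M ∸ 1) H)     ∎
  where
  open ≤-Reasoning
  open LogConvexSequence (cliqueFactor K) (cliqueFactor-logConvex K)
  k = suc K
  M = n ∸ k
  B : ℕ → ℕ
  B i = cliqueFactor K i * cliqueFactor K (M ∸ i)
  j≤M : j ≤ M
  j≤M = ≤-trans (m≤m+n j (j + 0)) 2j≤M
  1≤M : 1 ≤ M
  1≤M = ≤-trans (≤-trans (s≤s z≤n) 2≤j) j≤M
  hub-positive : 1 ≤ hubFactor H M
  hub-positive = ∏-positive k _ (λ h → selfPower-positive (degree H h + M))
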